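{- For $i=0,1,2$, the group $\mathscr{X}_{\tau}=\jmath_{\tau}(\mathrm{GL}_{2}(\mathcal{O}_{F}))$ is a subgroup of $H'_{\tau_{i}}=H'\cap\tau_{i}K\tau_{i}^{ -1}$. In particular, $\mathrm{pr}'_{1}(H'_{\tau_{i}})=\mathrm{GL}_{2}(\mathcal{O}_{F})$, where $\mathrm{pr}'_{1}:H'\to\mathrm{GL}_2(F)$ is the projection onto the $\mathrm{GL}_2$-factor.
   Context: Let $F$ be a local field of characteristic zero, $\mathcal{O}_{F}$ its ring of integers and $\varpi$ a uniformizer. Let $G=\mathrm{GSp}_{6}(F)$ (w.r.t. $J=\left(\begin{smallmatrix} & 1_{3}\\ -1_{3} & \end{smallmatrix}\right)$), $K=\mathrm{GSp}_{6}(\mathcal{O}_{F})$, and $H'=\mathrm{GL}_{2}(F)\times_{F^{\times}}\mathrm{GSp}_{4}(F)$ embedded in $G$ via $\left(\left(\begin{smallmatrix} a&b\\ c&d\end{smallmatrix}\right),\left(\begin{smallmatrix} A&B\\ C&D\end{smallmatrix}\right)\right)\mapsto\left(\begin{smallmatrix} a&&b&\\ &A&&B\\ c&&d&\\ &C&&D\end{smallmatrix}\right)$. Let $\jmath_{\tau}:\mathrm{GL}_{2}\to\mathrm{GL}_2\times_{\mathbb{G}_m}\mathrm{GSp}_4$ be the embedding $\left(\begin{smallmatrix} a&b\\ c&d\end{smallmatrix}\right)\mapsto\left(\left(\begin{smallmatrix} a&b\\ c&d\end{smallmatrix}\right),\left(\begin{smallmatrix} d&&c&\\ &1&&\\ b&&a&\\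 &&&ad-bc\end{smallmatrix}\right)\right)$. Let $\tau_{0}=1_{G}$, $$\tau_{1}=\left(\begin{smallmatrix}\varpi&&&&1&\\ &\varpi&&1&&\\ &&\varpi&&&\\ &&&1&&\\ &&&&1&\\ &&&&&1\end{smallmatrix}\right),\qquad \tau_{2}=\left(\begin{smallmatrix}\varpi&&&&\varpi^{ -1}&\\ &\varpi&&\varpi^{ -1}&&\\ &&1&&&\\ &&&\varpi^{ -1}&&\\ &&&&\varpi^{ -1}&\\ &&&&&1\end{smallmatrix}\right).$$ -}

module Defs where

open import Level using (0ℓ)
open import Algebra.Bundles using (CommutativeRing)
open import Data.Nat using (ℕ; zero; suc)
open import Data.Fin using (Fin; zero; suc; splitAt; _≟_)
open import Data.Sum using (_⊎_; inj₁; inj₂)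
open import Data.Product using (Σ; ∃; _×_; _,_)
open import Data.List using (List)
open import Data.List.Membership.Propositional using (_∈_)
open import Data.Empty using (⊥)
open import Relation.Nullary using (¬_; yes; no)
open import Relation.Binary.PropositionalEquality using (_≡_)

-- Non-archimedean local fields of characteristic zero, axiomatised as
-- complete discretely valued fields with finite residue field:
--   * a field F (commutative ring, 1 ≉ 0, every nonzero element has an
--     inverse given by _⁻¹),
--   * its ring of integers O (a subring which is a valuation ring),
--   * a uniformizer ϖ ∈ O generating the unique maximal ideal of O,
--   * O is ϖ-adically separated and complete,
--   * the residue field O/ϖO is finite,
--   * F has characteristic zero.

module RingOps (R : CommutativeRing 0ℓ 0ℓ) where
  open CommutativeRing R using (Carrier; _+_; _*_; 0#; 1#)

  _•_ : ℕ → Carrier → Carrier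
  zero  • x = 0#
  suc n • x = x + (n • x)

  _^_ : Carrier → ℕ → Carrier
  x ^ zero  = 1#
  x ^ suc n = x * (x ^ n)

record LocalField : Set₁ where
  field
    ℱ : CommutativeRing 0ℓ 0ℓ
  open CommutativeRing ℱ public
    using (Carrier; _≈_; _+_; _*_; -_; _-_; 0#; 1#)

  open RingOps ℱ public

  field
    _⁻¹       : Carrier → Carrier
    1≉0       : ¬ (1# ≈ 0#)
    ⁻¹-inverse : ∀ x → ¬ (x ≈ 0#) → x * (x ⁻¹) ≈ 1#
    𝒪         : Carrier → Set
    𝒪-resp    : ∀ {x y} → x ≈ y → 𝒪 x → 𝒪 y
    𝒪-0       : 𝒪 0#
    𝒪-1       : 𝒪 1#
    𝒪-+       : ∀ {x y} → 𝒪 x → 𝒪 y → 𝒪 (x + y)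
    𝒪-neg     : ∀ {x} → 𝒪 x → 𝒪 (- x)
    𝒪-*       : ∀ {x y} → 𝒪 x → 𝒪 y → 𝒪 (x * y)
    𝒪-valuation : ∀ x y → x * y ≈ 1# → 𝒪 x ⊎ 𝒪 y
    ϖ         : Carrier
    ϖ∈𝒪       : 𝒪 ϖ
    ϖ-nonunit : ¬ (Σ Carrier λ y → 𝒪 y × (ϖ * y ≈ 1#))
    ϖ-maximal : ∀ x → 𝒪 x → ¬ (Σ Carrier λ y → 𝒪 y × (x * y ≈ 1#))
                → Σ Carrier λ y → 𝒪 y × (x ≈ ϖ * y)
    separated : ∀ x → (∀ n → Σ Carrier λ y → 𝒪 y × (x ≈ (ϖ ^ n) * y)) → x ≈ 0#
    complete  : (a : ℕ → Carrier) → (∀ n → 𝒪 (a n))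
                → (∀ n → Σ Carrier λ y → 𝒪 y × (a (suc n) - a n ≈ (ϖ ^ n) * y))
                → Σ Carrier λ L → 𝒪 L ×
                    (∀ n → Σ Carrier λ y → 𝒪 y × (L - a n ≈ (ϖ ^ n) * y))
    residues     : List Carrier
    residues-𝒪   : ∀ r → r ∈ residues → 𝒪 r
    residues-all : ∀ x → 𝒪 x → Σ Carrier λ r → r ∈ residues ×
                     (Σ Carrier λ y → 𝒪 y × (x - r ≈ ϖ * y))
    char0 : ∀ n → n • 1# ≈ 0# → n ≡ 0

module WithF (F : LocalField) where
  open LocalField F using (Carrier; _≈_; _+_; _*_; -_; _-_; 0#; 1#; 𝒪; ϖ; _⁻¹)

  Mat : ℕ → ℕ → Set
  Mat m n = Fin m → Fin n → Carrier

  ∑ : ∀ {n} → (Fin n → Carrier) → Carrier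
  ∑ {zero}  f = 0#
  ∑ {suc n} f = f zero + ∑ (λ i → f (suc i))

  _⊗_ : ∀ {m n p} → Mat m n → Mat n p → Mat m p
  (A ⊗ B) i k = ∑ (λ j → A i j * B j k)

  transpose : ∀ {m n} → Mat m n → Mat n m
  transpose A i j = A j i

  scale : ∀ {m n} → Carrier → Mat m n → Mat m n
  scale c A i j = c * A i j

  _≐_ : ∀ {m n} → Mat m n → Mat m n → Set
  A ≐ B = ∀ i j → A i j ≈ B i j

  J : (m : ℕ) → Mat (m Data.Nat.+ m) (m Data.Nat.+ m)
  J m i j with splitAt m i | splitAt m j
  ... | inj₁ p | inj₂ q with p ≟ q
  ...   | yes _ = 1#
  ...   | no  _ = 0#
  J m i j | inj₂ p | inj₁ q with p ≟ q
  ...   | yes _ = - 1#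
  ...   | no  _ = 0#
  J m i j | _ | _ = 0#

  Unit𝒪 : Carrier → Set
  Unit𝒪 x = 𝒪 x × (Σ Carrier λ y → 𝒪 y × (x * y ≈ 1#))

  Integral : ∀ {m n} → Mat m n → Set
  Integral A = ∀ i j → 𝒪 (A i j)

  SympWith : (m : ℕ) → Mat (m Data.Nat.+ m) (m Data.Nat.+ m) → Carrier → Set
  SympWith m A ν = (transpose A ⊗ (J m ⊗ A)) ≐ scale ν (J m)

  det2 : Mat 2 2 → Carrier
  det2 g = g zero zero * g (suc zero) (suc zero) - g zero (suc zero) * g (suc zero) zero

  GL2F : Mat 2 2 → Set
  GL2F g = ¬ (det2 g ≈ 0#)

  GL2𝒪 : Mat 2 2 → Set
  GL2𝒪 g = Integral g × Unit𝒪 (det2 g)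

  InK : Mat 6 6 → Set
  InK k = Integral k × (Σ Carrier λ ν → Unit𝒪 ν × SympWith 3 k ν)

  -- H' = GL₂(F) ×_{F^×} GSp₄(F): pairs (g, A) with g ∈ GL₂(F) and
  -- A ∈ GSp₄(F) with similitude factor det g.
  InH' : Mat 2 2 → Mat 4 4 → Set
  InH' g A = GL2F g × SympWith 2 A (det2 g)

  idx : Fin 6 → Fin 2 ⊎ Fin 4
  idx zero = inj₁ zero
  idx (suc zero) = inj₂ zero
  idx (suc (suc zero)) = inj₂ (suc zero)
  idx (suc (suc (suc zero))) = inj₁ (suc zero)
  idx (suc (suc (suc (suc zero)))) = inj₂ (suc (suc zero))
  idx (suc (suc (suc (suc (suc zero))))) = inj₂ (suc (suc (suc zero)))

  embed : Mat 2 2 → Mat 4 4 → Mat 6 6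
  embed g A i j with idx i | idx j
  ... | inj₁ p | inj₁ q = g p q
  ... | inj₂ p | inj₂ q = A p q
  ... | _      | _      = 0#

  -- ȷ_τ : GL₂ → GL₂ ×_{𝔾ₘ} GSp₄, second component
  ȷ₂ : Mat 2 2 → Mat 4 4
  ȷ₂ g zero zero = g (suc zero) (suc zero)
  ȷ₂ g zero (suc (suc zero)) = g (suc zero) zero
  ȷ₂ g (suc zero) (suc zero) = 1#
  ȷ₂ g (suc (suc zero)) zero = g zero (suc zero)
  ȷ₂ g (suc (suc zero)) (suc (suc zero)) = g zero zero
  ȷ₂ g (suc (suc (suc zero))) (suc (suc (suc zero))) = det2 g
  ȷ₂ g _ _ = 0#

  -- the matrices τ₀, τ₁, τ₂ (indices 0-based)
  ϖ⁻¹ : Carrier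
  ϖ⁻¹ = ϖ ⁻¹

  diag6 : (Fin 6 → Carrier) → Mat 6 6
  diag6 d i j with i ≟ j
  ... | yes _ = d i
  ... | no  _ = 0#

  τ : Fin 3 → Mat 6 6
  τ zero i j = diag6 (λ _ → 1#) i j
  τ (suc zero) zero (suc (suc (suc (suc zero)))) = 1#
  τ (suc zero) (suc zero) (suc (suc (suc zero))) = 1#
  τ (suc zero) i j =
    diag6 (λ { zero → ϖ ; (suc zero) → ϖ ; (suc (suc zero)) → ϖ ; _ → 1# }) i j
  τ (suc (suc zero)) zero (suc (suc (suc (suc zero)))) = ϖ⁻¹
  τ (suc (suc zero)) (suc zero) (suc (suc (suc zero))) = ϖ⁻¹
  τ (suc (suc zero)) i j =
    diag6 (λ { zero → ϖ ; (suc zero) → ϖ ; (suc (suc zero)) → 1#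
             ; (suc (suc (suc zero))) → ϖ⁻¹ ; (suc (suc (suc (suc zero)))) → ϖ⁻¹
             ; _ → 1# }) i j

  -- h ∈ τ K τ⁻¹, i.e. h = τ k τ⁻¹ for some k ∈ K (τ is invertible)
  InConjK : Fin 3 → Mat 6 6 → Set
  InConjK i h = Σ (Mat 6 6) λ k → InK k × ((h ⊗ τ i) ≐ (τ i ⊗ k))

  InH'τ : Fin 3 → Mat 2 2 → Mat 4 4 → Set
  InH'τ i g A = InH' g A × InConjK i (embed g A)

-- Each τᵢ is a τ-matrix x s t u: diag(x, x, s, t, t, 1) plus u in the entries (0,4) and (1,3)
-- (indices from 0), whose ratios p = x/t and q = u/t are integral and generate 𝒪:
-- (p, q) = (1, 0), (ϖ, 1), (ϖ², 1) for i = 0, 1, 2.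
--
-- 𝒳_τ ⊆ H'_τᵢ: for τ₀ take k = ȷ(g) itself; for τ₁, τ₂ (where q = 1) the matrix k = τ⁻¹ ȷ(g) τ
-- is written down explicitly.  Its entries are polynomials in p and the entries of g, so k is
-- integral, and it is a similitude with factor det g.
--
-- pr'₁(H'_τᵢ) ⊆ GL₂(𝒪): if (g, A) τ = τ k with k ∈ K and g = (a b; c d), comparing entries of
-- both sides gives k e₀ = (a, -qc, 0, pc, 0, 0), k₃₃ = d, b = p k₀₃ + q k₄₃ and qc = k₃₄, so g is
-- integral (for c write 1 = αp + βq with α, β ∈ 𝒪); and entry (0,3) of kᵀ J k = ν J reads
-- ν = ω(k e₀, k e₃) = ad - bc, so det g = ν is a unit.
--
-- All matrix identities are polynomial identities, decided by normalising polynomials with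
-- integer coefficients.

module Submission where

open import Defs
open import Data.Fin using (Fin)
open import Data.Product using (Σ; _×_)
open import Function.Bundles using (_⇔_)

open import Level using (0ℓ)
open import Algebra.Bundles using (CommutativeRing; RawRing)
open import Algebra.Solver.Ring.AlmostCommutativeRing
  using (_-Raw-AlmostCommutative⟶_; fromCommutativeRing)
open import Data.Bool using (Bool; true; false; T; _∧_)
open import Data.Bool.Properties using (T?; T-∧)
open import Data.Fin using (zero; suc; toℕ; splitAt; _≟_; #_; _↑ˡ_; _↑ʳ_; combine; remQuot)
import Data.Fin.Properties as Fin
open import Data.Integer as ℤ using (ℤ; +_; -[1+_]; _⊖_)
import Data.Integer.Properties as ℤ
import Data.List as List
open import Data.List.Membership.Propositional using (_∈_)
import Data.List.Relation.Unary.Any as Any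
import Data.List.Relation.Unary.Any.Properties as Any
open import Data.Maybe using (Maybe; just; nothing; is-just)
open import Data.Nat as ℕ using (ℕ; zero; suc)
import Data.Nat.Properties as ℕ
open import Data.Product using (_,_; proj₁; proj₂; uncurry)
open import Data.Sum using (inj₁; inj₂)
open import Data.Vec as Vec using (Vec; []; _∷_; lookup; tabulate; _++_)
import Data.Vec.Properties as Vec
open import Function.Bundles using (Equivalence; mk⇔)
open import Relation.Nullary using (¬_; yes; no)
open import Relation.Nullary.Decidable using (Dec; True; toWitness)
import Relation.Binary.PropositionalEquality as ≡

-- The ring solver of Algebra.Solver.Ring needs a coefficient ring with decidable equality that
-- maps into the given ring; ℤ does so for every commutative ring.
module IntegerCoefficients (R : CommutativeRing 0ℓ 0ℓ) where
  open CommutativeRing R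
  open import Algebra.Properties.Ring ring using (-‿distribˡ-*; -‿distribʳ-*; -‿involutive; -0#≈0#)
  open import Algebra.Properties.AbelianGroup +-abelianGroup
    using (⁻¹-∙-comm; xyx⁻¹≈y; ⁻¹-anti-homo‿-)
  open import Algebra.Properties.Semiring.Mult.TCOptimised semiring using (×-homo-+; ×1-homo-*)
    renaming (_×_ to _·_)
  open import Relation.Binary.Reasoning.Setoid setoid

  ⟦_⟧ℤ : ℤ → Carrier
  ⟦ + n ⟧ℤ      = n · 1#
  ⟦ -[1+ n ] ⟧ℤ = - (suc n · 1#)

  ⟦-⟧ℤ : ∀ i → ⟦ ℤ.- i ⟧ℤ ≈ - ⟦ i ⟧ℤ
  ⟦-⟧ℤ (+ zero)  = sym -0#≈0#
  ⟦-⟧ℤ (+ suc n) = refl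
  ⟦-⟧ℤ -[1+ n ]  = sym (-‿involutive _)

  ⟦⊖⟧ℤ-≥ : ∀ {m n} → n ℕ.≤ m → ⟦ m ⊖ n ⟧ℤ ≈ m · 1# - n · 1#
  ⟦⊖⟧ℤ-≥ {m} {n} n≤m = begin
    ⟦ m ⊖ n ⟧ℤ                       ≡⟨ ≡.cong ⟦_⟧ℤ (ℤ.⊖-≥ n≤m) ⟩
    (m ℕ.∸ n) · 1#                   ≈⟨ xyx⁻¹≈y (n · 1#) _ ⟨
    n · 1# + (m ℕ.∸ n) · 1# - n · 1# ≈⟨ +-congʳ (×-homo-+ 1# n (m ℕ.∸ n)) ⟨
    (n ℕ.+ (m ℕ.∸ n)) · 1# - n · 1#  ≡⟨ ≡.cong (λ k → k · 1# - n · 1#) (ℕ.m+[n∸m]≡n n≤m) ⟩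
    m · 1# - n · 1#                  ∎

  ⟦⊖⟧ℤ : ∀ m n → ⟦ m ⊖ n ⟧ℤ ≈ m · 1# - n · 1#
  ⟦⊖⟧ℤ m n with ℕ.≤-total n m
  ... | inj₁ n≤m = ⟦⊖⟧ℤ-≥ n≤m
  ... | inj₂ m≤n = begin
    ⟦ m ⊖ n ⟧ℤ          ≡⟨ ≡.cong ⟦_⟧ℤ (ℤ.⊖-swap m n) ⟩
    ⟦ ℤ.- (n ⊖ m) ⟧ℤ    ≈⟨ ⟦-⟧ℤ (n ⊖ m) ⟩
    - ⟦ n ⊖ m ⟧ℤ        ≈⟨ -‿cong (⟦⊖⟧ℤ-≥ m≤n) ⟩
    - (n · 1# - m · 1#) ≈⟨ ⁻¹-anti-homo‿- (n · 1#) (m · 1#) ⟩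
    m · 1# - n · 1#     ∎

  ⟦+⟧ℤ : ∀ i j → ⟦ i ℤ.+ j ⟧ℤ ≈ ⟦ i ⟧ℤ + ⟦ j ⟧ℤ
  ⟦+⟧ℤ (+ m)     (+ n)     = ×-homo-+ 1# m n
  ⟦+⟧ℤ (+ m)     -[1+ n ]  = ⟦⊖⟧ℤ m (suc n)
  ⟦+⟧ℤ -[1+ m ]  (+ n)     = trans (⟦⊖⟧ℤ n (suc m)) (+-comm _ _)
  ⟦+⟧ℤ -[1+ m ]  -[1+ n ]  = begin
    - (suc (suc (m ℕ.+ n)) · 1#)  ≡⟨ ≡.cong (λ k → - (suc k · 1#)) (ℕ.+-suc m n) ⟨
    - ((suc m ℕ.+ suc n) · 1#)    ≈⟨ -‿cong (×-homo-+ 1# (suc m) (suc n)) ⟩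
    - (suc m · 1# + suc n · 1#)   ≈⟨ ⁻¹-∙-comm _ _ ⟨
    - (suc m · 1#) - suc n · 1#   ∎

  ⟦*⟧ℤ-+ : ∀ m j → ⟦ + m ℤ.* j ⟧ℤ ≈ ⟦ + m ⟧ℤ * ⟦ j ⟧ℤ
  ⟦*⟧ℤ-+ m (+ n)    = trans (reflexive (≡.cong ⟦_⟧ℤ (≡.sym (ℤ.pos-* m n)))) (×1-homo-* m n)
  ⟦*⟧ℤ-+ m -[1+ n ] = begin
    ⟦ + m ℤ.* ℤ.- (+ suc n) ⟧ℤ  ≡⟨ ≡.cong ⟦_⟧ℤ (ℤ.neg-distribʳ-* (+ m) (+ suc n)) ⟨
    ⟦ ℤ.- (+ m ℤ.* + suc n) ⟧ℤ  ≈⟨ ⟦-⟧ℤ (+ m ℤ.* + suc n) ⟩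
    - ⟦ + m ℤ.* + suc n ⟧ℤ      ≈⟨ -‿cong (⟦*⟧ℤ-+ m (+ suc n)) ⟩
    - (⟦ + m ⟧ℤ * ⟦ + suc n ⟧ℤ) ≈⟨ -‿distribʳ-* _ _ ⟩
    ⟦ + m ⟧ℤ * ⟦ -[1+ n ] ⟧ℤ    ∎

  ⟦*⟧ℤ : ∀ i j → ⟦ i ℤ.* j ⟧ℤ ≈ ⟦ i ⟧ℤ * ⟦ j ⟧ℤ
  ⟦*⟧ℤ (+ m)    j = ⟦*⟧ℤ-+ m j
  ⟦*⟧ℤ -[1+ m ] j = begin
    ⟦ ℤ.- (+ suc m) ℤ.* j ⟧ℤ   ≡⟨ ≡.cong ⟦_⟧ℤ (ℤ.neg-distribˡ-* (+ suc m) j) ⟨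
    ⟦ ℤ.- (+ suc m ℤ.* j) ⟧ℤ   ≈⟨ ⟦-⟧ℤ (+ suc m ℤ.* j) ⟩
    - ⟦ + suc m ℤ.* j ⟧ℤ       ≈⟨ -‿cong (⟦*⟧ℤ-+ (suc m) j) ⟩
    - (⟦ + suc m ⟧ℤ * ⟦ j ⟧ℤ)  ≈⟨ -‿distribˡ-* _ _ ⟩
    ⟦ -[1+ m ] ⟧ℤ * ⟦ j ⟧ℤ     ∎

  ℤ⟶R : ℤ.+-*-rawRing -Raw-AlmostCommutative⟶ fromCommutativeRing R
  ℤ⟶R = record
    { ⟦_⟧    = ⟦_⟧ℤ
    ; +-homo = ⟦+⟧ℤ
    ; *-homo = ⟦*⟧ℤ
    ; -‿homo = ⟦-⟧ℤ
    ; 0-homo = refl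
    ; 1-homo = refl
    }

  ⟦≟⟧ℤ : ∀ i j → Maybe (⟦ i ⟧ℤ ≈ ⟦ j ⟧ℤ)
  ⟦≟⟧ℤ i j with i ℤ.≟ j
  ... | yes i≡j = just (reflexive (≡.cong ⟦_⟧ℤ i≡j))
  ... | no _    = nothing

  open import Algebra.Solver.Ring ℤ.+-*-rawRing (fromCommutativeRing R) ℤ⟶R ⟦≟⟧ℤ public

  equal? : ∀ {n} → Polynomial n → Polynomial n → Bool
  equal? p q = is-just (normalise p ≟N normalise q)

  equal?-sound : ∀ {n} (p q : Polynomial n) → T (equal? p q) → ∀ ρ → ⟦ p ⟧ ρ ≈ ⟦ q ⟧ ρ
  equal?-sound p q _ ρ with normalise p ≟N normalise q
  ... | just p≈q = prove ρ p q (⟦ p≈q ⟧N-cong ρ)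

all₂ : {P : Fin 2 → Set} → P (# 0) → P (# 1) → ∀ i → P i
all₂ p₀ p₁ zero       = p₀
all₂ p₀ p₁ (suc zero) = p₁

all₄ : {P : Fin 4 → Set} → P (# 0) → P (# 1) → P (# 2) → P (# 3) → ∀ i → P i
all₄ p₀ p₁ p₂ p₃ zero                   = p₀
all₄ p₀ p₁ p₂ p₃ (suc zero)             = p₁
all₄ p₀ p₁ p₂ p₃ (suc (suc zero))       = p₂
all₄ p₀ p₁ p₂ p₃ (suc (suc (suc zero))) = p₃

all₆ : {P : Fin 6 → Set} → P (# 0) → P (# 1) → P (# 2) → P (# 3) → P (# 4) → P (# 5) → ∀ i → P i
all₆ p₀ p₁ p₂ p₃ p₄ p₅ zero                               = p₀
all₆ p₀ p₁ p₂ p₃ p₄ p₅ (suc zero)                         = p₁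
all₆ p₀ p₁ p₂ p₃ p₄ p₅ (suc (suc zero))                   = p₂
all₆ p₀ p₁ p₂ p₃ p₄ p₅ (suc (suc (suc zero)))             = p₃
all₆ p₀ p₁ p₂ p₃ p₄ p₅ (suc (suc (suc (suc zero))))       = p₄
all₆ p₀ p₁ p₂ p₃ p₄ p₅ (suc (suc (suc (suc (suc zero))))) = p₅

fromRows : ∀ {X : Set} {a b} → Vec (Vec X b) a → Fin a → Fin b → X
fromRows rows i j = lookup (lookup rows i) j

entries : ∀ {X : Set} {a b} → (Fin a → Fin b → X) → Vec X (a ℕ.* b)
entries {b = b} M = tabulate (λ v → uncurry M (remQuot b v))

lookup-entries : ∀ {X : Set} {a b} (M : Fin a → Fin b → X) i j →
                 lookup (entries M) (combine i j) ≡.≡ M i j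
lookup-entries M i j =
  ≡.trans (Vec.lookup∘tabulate _ (combine i j)) (≡.cong (uncurry M) (Fin.remQuot-combine i j))

module Patterns (R : RawRing 0ℓ 0ℓ) where
  open RawRing R

  τ-rows : Carrier → Carrier → Carrier → Carrier → Vec (Vec Carrier 6) 6
  τ-rows x s t u =
      (x  ∷ 0# ∷ 0# ∷ 0# ∷ u  ∷ 0# ∷ [])
    ∷ (0# ∷ x  ∷ 0# ∷ u  ∷ 0# ∷ 0# ∷ [])
    ∷ (0# ∷ 0# ∷ s  ∷ 0# ∷ 0# ∷ 0# ∷ [])
    ∷ (0# ∷ 0# ∷ 0# ∷ t  ∷ 0# ∷ 0# ∷ [])
    ∷ (0# ∷ 0# ∷ 0# ∷ 0# ∷ t  ∷ 0# ∷ [])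
    ∷ (0# ∷ 0# ∷ 0# ∷ 0# ∷ 0# ∷ 1# ∷ [])
    ∷ []

  ȷ₂-rows : Carrier → Carrier → Carrier → Carrier → Vec (Vec Carrier 4) 4
  ȷ₂-rows a b c d =
      (d  ∷ 0# ∷ c  ∷ 0# ∷ [])
    ∷ (0# ∷ 1# ∷ 0# ∷ 0# ∷ [])
    ∷ (b  ∷ 0# ∷ a  ∷ 0# ∷ [])
    ∷ (0# ∷ 0# ∷ 0# ∷ a * d + - (b * c) ∷ [])
    ∷ []

  -- τ⁻¹ · embed g (ȷ₂ g) · τ for g = (a b; c d) and the τ-matrix (t * p) s t t.
  ȷ-conjugate-rows : Carrier → Carrier → Carrier → Carrier → Carrier → Vec (Vec Carrier 6) 6
  ȷ-conjugate-rows a b c d p =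
      (a     ∷ - b   ∷ 0# ∷ 0# ∷ 0# ∷ 0# ∷ [])
    ∷ (- c   ∷ d     ∷ 0# ∷ 0# ∷ 0# ∷ 0# ∷ [])
    ∷ (0#    ∷ 0#    ∷ 1# ∷ 0# ∷ 0# ∷ 0# ∷ [])
    ∷ (p * c ∷ 0#    ∷ 0# ∷ d  ∷ c  ∷ 0# ∷ [])
    ∷ (0#    ∷ p * b ∷ 0# ∷ b  ∷ a  ∷ 0# ∷ [])
    ∷ (0#    ∷ 0#    ∷ 0# ∷ 0# ∷ 0# ∷ a * d + - (b * c) ∷ [])
    ∷ []

  -- ω(v, w) = vᵀ (J 3) w.
  pairing : (Fin 6 → Carrier) → (Fin 6 → Carrier) → Carrier
  pairing v w = (v (# 0) * w (# 3) + - (v (# 3) * w (# 0)))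
              + (v (# 1) * w (# 4) + - (v (# 4) * w (# 1)))
              + (v (# 2) * w (# 5) + - (v (# 5) * w (# 2)))

module _ (F : LocalField) where
  open LocalField F
    using (ℱ; 𝒪; 𝒪-resp; 𝒪-0; 𝒪-1; 𝒪-+; 𝒪-neg; 𝒪-*; ϖ; ϖ∈𝒪; _⁻¹; ⁻¹-inverse; 1≉0;
           residues; residues-all; char0; _•_)
  open WithF F
  open CommutativeRing ℱ hiding (zero)
  open IntegerCoefficients ℱ
  open import Algebra.Properties.Group +-group using (x∙y⁻¹≈ε⇒x≈y; identityʳ-unique; inverseˡ-unique)
  open import Relation.Binary.Reasoning.Setoid setoid

  nonzero-cancelˡ : ∀ {x y z} → ¬ x ≈ 0# → x * y ≈ x * z → y ≈ z
  nonzero-cancelˡ {x} {y} {z} x≉0 xy≈xz = begin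
    y                ≈⟨ *-identityˡ y ⟨
    1# * y           ≈⟨ *-congʳ x⁻¹x≈1 ⟨
    x ⁻¹ * x * y     ≈⟨ *-assoc _ _ _ ⟩
    x ⁻¹ * (x * y)   ≈⟨ *-congˡ xy≈xz ⟩
    x ⁻¹ * (x * z)   ≈⟨ *-assoc _ _ _ ⟨
    x ⁻¹ * x * z     ≈⟨ *-congʳ x⁻¹x≈1 ⟩
    1# * z           ≈⟨ *-identityˡ z ⟩
    z                ∎
    where x⁻¹x≈1 = trans (*-comm _ _) (⁻¹-inverse x x≉0)

  nonzero-*-zero : ∀ {x y} → ¬ x ≈ 0# → 0# ≈ x * y → y ≈ 0#
  nonzero-*-zero {x} x≉0 0≈xy = nonzero-cancelˡ x≉0 (trans (sym 0≈xy) (sym (zeroʳ x)))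

  invertible⇒nonzero : ∀ {x y} → x * y ≈ 1# → ¬ x ≈ 0#
  invertible⇒nonzero {x} {y} xy≈1 x≈0 = 1≉0 (begin
    1#      ≈⟨ xy≈1 ⟨
    x * y   ≈⟨ *-congʳ x≈0 ⟩
    0# * y  ≈⟨ zeroˡ y ⟩
    0#      ∎)

  •-homo-+ : ∀ m n x → (m ℕ.+ n) • x ≈ m • x + n • x
  •-homo-+ zero    n x = sym (+-identityˡ _)
  •-homo-+ (suc m) n x = trans (+-congˡ (•-homo-+ m n x)) (sym (+-assoc _ _ _))

  •1∈𝒪 : ∀ n → 𝒪 (n • 1#)
  •1∈𝒪 zero    = 𝒪-0
  •1∈𝒪 (suc n) = 𝒪-+ 𝒪-1 (•1∈𝒪 n)

  •1-collision : ∀ {m n} → m ℕ.≤ n → m • 1# ≈ n • 1# → (n ℕ.∸ m) • 1# ≈ 0#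
  •1-collision {m} {n} m≤n m•1≈n•1 = identityʳ-unique (m • 1#) _ (begin
    m • 1# + (n ℕ.∸ m) • 1#  ≈⟨ •-homo-+ m (n ℕ.∸ m) 1# ⟨
    (m ℕ.+ (n ℕ.∸ m)) • 1#   ≡⟨ ≡.cong (_• 1#) (ℕ.m+[n∸m]≡n m≤n) ⟩
    n • 1#                   ≈⟨ m•1≈n•1 ⟨
    m • 1#                   ∎)

  ϖ≈0⇒residue : ϖ ≈ 0# → ∀ x → 𝒪 x → Σ Carrier λ r → r ∈ residues × x ≈ r
  ϖ≈0⇒residue ϖ≈0 x x∈𝒪 with residues-all x x∈𝒪
  ... | r , r∈residues , y , _ , x-r≈ϖy =
    r , r∈residues , x∙y⁻¹≈ε⇒x≈y x r (trans x-r≈ϖy (trans (*-congʳ ϖ≈0) (zeroˡ y)))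

  module _ (ϖ≈0 : ϖ ≈ 0#) where
    residue-of : ∀ k → Σ Carrier λ r → r ∈ residues × k • 1# ≈ r
    residue-of k = ϖ≈0⇒residue ϖ≈0 (k • 1#) (•1∈𝒪 k)

    residue-index : Fin (suc (List.length residues)) → Fin (List.length residues)
    residue-index k = Any.index (proj₁ (proj₂ (residue-of (toℕ k))))

    •1≈residue : ∀ k → toℕ k • 1# ≈ List.lookup residues (residue-index k)
    •1≈residue k = trans (proj₂ (proj₂ (residue-of (toℕ k))))
                         (reflexive (Any.lookup-index (proj₁ (proj₂ (residue-of (toℕ k))))))

  -- If ϖ ≈ 0, the finitely many residues would represent all of 0, 1, 2, …, which are pairwise
  -- distinct in characteristic zero.
  ϖ≉0 : ¬ ϖ ≈ 0#
  ϖ≉0 ϖ≈0 with Fin.pigeonhole (ℕ.n<1+n (List.length residues)) (residue-index ϖ≈0)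
  ... | i , j , i<j , same-index =
    ℕ.<⇒≢ (ℕ.m<n⇒0<n∸m i<j) (≡.sym (char0 _ (•1-collision (ℕ.<⇒≤ i<j) i•1≈j•1)))
    where
    i•1≈j•1 : toℕ i • 1# ≈ toℕ j • 1#
    i•1≈j•1 = trans (•1≈residue ϖ≈0 i)
      (trans (reflexive (≡.cong (List.lookup residues) same-index)) (sym (•1≈residue ϖ≈0 j)))

  ϖ*ϖ⁻¹≈1 : ϖ * ϖ ⁻¹ ≈ 1#
  ϖ*ϖ⁻¹≈1 = ⁻¹-inverse ϖ ϖ≉0

  ϖ⁻¹≉0 : ¬ ϖ ⁻¹ ≈ 0#
  ϖ⁻¹≉0 = invertible⇒nonzero (trans (*-comm _ _) ϖ*ϖ⁻¹≈1)

  ϖ≈ϖ⁻¹*[ϖ*ϖ] : ϖ ≈ ϖ ⁻¹ * (ϖ * ϖ)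
  ϖ≈ϖ⁻¹*[ϖ*ϖ] = sym (begin
    ϖ ⁻¹ * (ϖ * ϖ)  ≈⟨ *-assoc _ _ _ ⟨
    ϖ ⁻¹ * ϖ * ϖ    ≈⟨ *-congʳ (trans (*-comm _ _) ϖ*ϖ⁻¹≈1) ⟩
    1# * ϖ          ≈⟨ *-identityˡ ϖ ⟩
    ϖ               ∎)

  ≐-refl : ∀ {a b} {A : Mat a b} → A ≐ A
  ≐-refl _ _ = refl

  ≐-sym : ∀ {a b} {A B : Mat a b} → A ≐ B → B ≐ A
  ≐-sym A≐B i j = sym (A≐B i j)

  ≐-trans : ∀ {a b} {A B C : Mat a b} → A ≐ B → B ≐ C → A ≐ C
  ≐-trans A≐B B≐C i j = trans (A≐B i j) (B≐C i j)

  ∑-cong : ∀ {k} {f f′ : Fin k → Carrier} → (∀ i → f i ≈ f′ i) → ∑ f ≈ ∑ f′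
  ∑-cong {zero}  f≈f′ = refl
  ∑-cong {suc k} f≈f′ = +-cong (f≈f′ zero) (∑-cong (λ i → f≈f′ (suc i)))

  ⊗-cong : ∀ {a b c} {A A′ : Mat a b} {B B′ : Mat b c} → A ≐ A′ → B ≐ B′ → (A ⊗ B) ≐ (A′ ⊗ B′)
  ⊗-cong A≐A′ B≐B′ i k = ∑-cong (λ j → *-cong (A≐A′ i j) (B≐B′ j k))

  conjugation-resp : ∀ (h k : Mat 6 6) {T T′} → T ≐ T′ → (h ⊗ T′) ≐ (T′ ⊗ k) → (h ⊗ T) ≐ (T ⊗ k)
  conjugation-resp h k T≐T′ hT′≐T′k =
    ≐-trans (⊗-cong (≐-refl {A = h}) T≐T′) (≐-trans hT′≐T′k (⊗-cong (≐-sym T≐T′) (≐-refl {A = k})))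

  SympWith-resp : ∀ {m A B ν μ} → A ≐ B → ν ≈ μ → SympWith m A ν → SympWith m B μ
  SympWith-resp {m} {A} {B} {ν} {μ} A≐B ν≈μ A-symp i j = begin
    (transpose B ⊗ (J m ⊗ B)) i j ≈⟨ ⊗-cong (λ i j → A≐B j i) (⊗-cong ≐-refl A≐B) i j ⟨
    (transpose A ⊗ (J m ⊗ A)) i j ≈⟨ A-symp i j ⟩
    ν * J m i j                   ≈⟨ *-congʳ ν≈μ ⟩
    μ * J m i j                   ∎

  embed-cong : ∀ {g g′ A A′} → g ≐ g′ → A ≐ A′ → embed g A ≐ embed g′ A′
  embed-cong g≐g′ A≐A′ i j with idx i | idx j
  ... | inj₁ p | inj₁ q = g≐g′ p q
  ... | inj₁ _ | inj₂ _ = refl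
  ... | inj₂ _ | inj₁ _ = refl
  ... | inj₂ p | inj₂ q = A≐A′ p q

  Integral-resp : ∀ {a b} {A B : Mat a b} → A ≐ B → Integral A → Integral B
  Integral-resp A≐B A∈𝒪 i j = 𝒪-resp (A≐B i j) (A∈𝒪 i j)

  Unit𝒪-resp : ∀ {x y} → x ≈ y → Unit𝒪 x → Unit𝒪 y
  Unit𝒪-resp x≈y (x∈𝒪 , z , z∈𝒪 , x*z≈1) = 𝒪-resp x≈y x∈𝒪 , z , z∈𝒪 , trans (*-congʳ (sym x≈y)) x*z≈1

  module Fᵣ = Patterns rawRing

  τ-matrix : Carrier → Carrier → Carrier → Carrier → Mat 6 6
  τ-matrix x s t u = fromRows (Fᵣ.τ-rows x s t u)

  τ-matrix-cong : ∀ {x x′ s s′ t t′ u u′} → x ≈ x′ → s ≈ s′ → t ≈ t′ → u ≈ u′ →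
                  τ-matrix x s t u ≐ τ-matrix x′ s′ t′ u′
  τ-matrix-cong x≈ s≈ t≈ u≈ = all₆
    (all₆ x≈ refl refl refl u≈ refl) (all₆ refl x≈ refl u≈ refl refl) (all₆ refl refl s≈ refl refl refl)
    (all₆ refl refl refl t≈ refl refl) (all₆ refl refl refl refl t≈ refl) (all₆ refl refl refl refl refl refl)

  τᵢ-matrix : Fin 3 → Mat 6 6
  τᵢ-matrix zero             = τ-matrix 1# 1# 1# 0#
  τᵢ-matrix (suc zero)       = τ-matrix ϖ ϖ 1# 1#
  τᵢ-matrix (suc (suc zero)) = τ-matrix ϖ 1# ϖ⁻¹ ϖ⁻¹

  τ≐τᵢ-matrix : ∀ i → τ i ≐ τᵢ-matrix i
  τ≐τᵢ-matrix zero = all₆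
    (all₆ refl refl refl refl refl refl) (all₆ refl refl refl refl refl refl) (all₆ refl refl refl refl refl refl)
    (all₆ refl refl refl refl refl refl) (all₆ refl refl refl refl refl refl) (all₆ refl refl refl refl refl refl)
  τ≐τᵢ-matrix (suc zero) = all₆
    (all₆ refl refl refl refl refl refl) (all₆ refl refl refl refl refl refl) (all₆ refl refl refl refl refl refl)
    (all₆ refl refl refl refl refl refl) (all₆ refl refl refl refl refl refl) (all₆ refl refl refl refl refl refl)
  τ≐τᵢ-matrix (suc (suc zero)) = all₆
    (all₆ refl refl refl refl refl refl) (all₆ refl refl refl refl refl refl) (all₆ refl refl refl refl refl refl)
    (all₆ refl refl refl refl refl refl) (all₆ refl refl refl refl refl refl) (all₆ refl refl refl refl refl refl)

  ȷ-conjugate : Mat 2 2 → Carrier → Mat 6 6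
  ȷ-conjugate g p =
    fromRows (Fᵣ.ȷ-conjugate-rows (g (# 0) (# 0)) (g (# 0) (# 1)) (g (# 1) (# 0)) (g (# 1) (# 1)) p)

  pairing : (Fin 6 → Carrier) → (Fin 6 → Carrier) → Carrier
  pairing = Fᵣ.pairing

  SMat : ℕ → ℕ → ℕ → Set
  SMat n a b = Fin a → Fin b → Polynomial n

  ⟦_⟧ₘ : ∀ {n a b} → SMat n a b → Vec Carrier n → Mat a b
  ⟦ S ⟧ₘ ρ i j = ⟦ S i j ⟧ ρ

  0ₛ 1ₛ : ∀ {n} → Polynomial n
  0ₛ = con (+ 0)
  1ₛ = con (+ 1)

  polynomialRing : ℕ → RawRing 0ℓ 0ℓ
  polynomialRing n = record
    { Carrier = Polynomial n ; _≈_ = ≡._≡_ ; _+_ = _:+_ ; _*_ = _:*_ ; -_ = :-_ ; 0# = 0ₛ ; 1# = 1ₛ }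

  module Sᵣ {n} = Patterns (polynomialRing n)

  ∑ₛ : ∀ {n k} → (Fin k → Polynomial n) → Polynomial n
  ∑ₛ {k = zero}  f = 0ₛ
  ∑ₛ {k = suc k} f = f zero :+ ∑ₛ (λ i → f (suc i))

  _⊗ₛ_ : ∀ {n a b c} → SMat n a b → SMat n b c → SMat n a c
  (S ⊗ₛ T) i k = ∑ₛ (λ j → S i j :* T j k)

  Jₛ : ∀ {n} (m : ℕ) → SMat n (m ℕ.+ m) (m ℕ.+ m)
  Jₛ m i j with splitAt m i | splitAt m j
  ... | inj₁ p | inj₂ q with p ≟ q
  ...   | yes _ = 1ₛ
  ...   | no  _ = 0ₛ
  Jₛ m i j | inj₂ p | inj₁ q with p ≟ q
  ...   | yes _ = :- 1ₛ
  ...   | no  _ = 0ₛ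
  Jₛ m i j | _ | _ = 0ₛ

  Sympₛ : ∀ {n} (m : ℕ) → SMat n (m ℕ.+ m) (m ℕ.+ m) → SMat n (m ℕ.+ m) (m ℕ.+ m)
  Sympₛ m M = (λ i j → M j i) ⊗ₛ (Jₛ m ⊗ₛ M)

  embedₛ : ∀ {n} → SMat n 2 2 → SMat n 4 4 → SMat n 6 6
  embedₛ G A i j with idx i | idx j
  ... | inj₁ p | inj₁ q = G p q
  ... | inj₂ p | inj₂ q = A p q
  ... | _      | _      = 0ₛ

  module _ {n} (ρ : Vec Carrier n) where
    ⟦∑ₛ⟧ : ∀ {k} (f : Fin k → Polynomial n) → ⟦ ∑ₛ f ⟧ ρ ≈ ∑ (λ i → ⟦ f i ⟧ ρ)
    ⟦∑ₛ⟧ {zero}  f = refl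
    ⟦∑ₛ⟧ {suc k} f = +-congˡ (⟦∑ₛ⟧ (λ i → f (suc i)))

    ⟦⊗ₛ⟧ : ∀ {a b c} (S : SMat n a b) (T : SMat n b c) → ⟦ S ⊗ₛ T ⟧ₘ ρ ≐ (⟦ S ⟧ₘ ρ ⊗ ⟦ T ⟧ₘ ρ)
    ⟦⊗ₛ⟧ S T i k = ⟦∑ₛ⟧ (λ j → S i j :* T j k)

    ⟦Jₛ⟧ : ∀ m → ⟦ Jₛ m ⟧ₘ ρ ≐ J m
    ⟦Jₛ⟧ m i j with splitAt m i | splitAt m j
    ... | inj₁ p | inj₂ q with p ≟ q
    ...   | yes _ = refl
    ...   | no  _ = refl
    ⟦Jₛ⟧ m i j | inj₂ p | inj₁ q with p ≟ q
    ...   | yes _ = refl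
    ...   | no  _ = refl
    ⟦Jₛ⟧ m i j | inj₁ _ | inj₁ _ = refl
    ⟦Jₛ⟧ m i j | inj₂ _ | inj₂ _ = refl

    ⟦Sympₛ⟧ : ∀ m M → ⟦ Sympₛ m M ⟧ₘ ρ ≐ (transpose (⟦ M ⟧ₘ ρ) ⊗ (J m ⊗ ⟦ M ⟧ₘ ρ))
    ⟦Sympₛ⟧ m M = ≐-trans (⟦⊗ₛ⟧ _ (Jₛ m ⊗ₛ M))
      (⊗-cong ≐-refl (≐-trans (⟦⊗ₛ⟧ (Jₛ m) M) (⊗-cong (⟦Jₛ⟧ m) ≐-refl)))

    ⟦embedₛ⟧ : ∀ G A → ⟦ embedₛ G A ⟧ₘ ρ ≐ embed (⟦ G ⟧ₘ ρ) (⟦ A ⟧ₘ ρ)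
    ⟦embedₛ⟧ G A i j with idx i | idx j
    ... | inj₁ _ | inj₁ _ = refl
    ... | inj₁ _ | inj₂ _ = refl
    ... | inj₂ _ | inj₁ _ = refl
    ... | inj₂ _ | inj₂ _ = refl

    ⟦fromRows⟧ : ∀ {a b} (rows : Vec (Vec (Polynomial n) b) a) →
                 ⟦ fromRows rows ⟧ₘ ρ ≐ fromRows (Vec.map (Vec.map (λ p → ⟦ p ⟧ ρ)) rows)
    ⟦fromRows⟧ rows i j = reflexive (≡.sym (≡.trans
      (≡.cong (λ row → lookup row j) (Vec.lookup-map i (Vec.map (λ p → ⟦ p ⟧ ρ)) rows))
      (Vec.lookup-map j (λ p → ⟦ p ⟧ ρ) (lookup rows i))))

  ⟦⊗ₛ⟧-≐ : ∀ {n a b c} (S : SMat n a b) (T : SMat n b c) ρ {A B} →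
           ⟦ S ⟧ₘ ρ ≐ A → ⟦ T ⟧ₘ ρ ≐ B → ⟦ S ⊗ₛ T ⟧ₘ ρ ≐ (A ⊗ B)
  ⟦⊗ₛ⟧-≐ S T ρ S≐A T≐B = ≐-trans (⟦⊗ₛ⟧ ρ S T) (⊗-cong S≐A T≐B)

  _≋?_ : ∀ {n a b} (S S′ : SMat n a b) → Dec (∀ i j → T (equal? (S i j) (S′ i j)))
  S ≋? S′ = Fin.all? λ i → Fin.all? λ j → T? (equal? (S i j) (S′ i j))

  ≋-sound : ∀ {n a b} (S S′ : SMat n a b) → True (S ≋? S′) → ∀ ρ → ⟦ S ⟧ₘ ρ ≐ ⟦ S′ ⟧ₘ ρ
  ≋-sound S S′ S≋S′ ρ i j = equal?-sound (S i j) (S′ i j) (toWitness S≋S′ i j) ρ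

  product-by-normalisation :
    ∀ {n a b c} (S : SMat n a b) (T : SMat n b c) (S′ : SMat n a b) (T′ : SMat n b c) →
    True ((S ⊗ₛ T) ≋? (S′ ⊗ₛ T′)) → ∀ ρ {A B A′ B′} →
    ⟦ S ⟧ₘ ρ ≐ A → ⟦ T ⟧ₘ ρ ≐ B → ⟦ S′ ⟧ₘ ρ ≐ A′ → ⟦ T′ ⟧ₘ ρ ≐ B′ → (A ⊗ B) ≐ (A′ ⊗ B′)
  product-by-normalisation S T S′ T′ ST≋S′T′ ρ S≐A T≐B S′≐A′ T′≐B′ =
    ≐-trans (≐-sym (⟦⊗ₛ⟧-≐ S T ρ S≐A T≐B))
      (≐-trans (≋-sound (S ⊗ₛ T) (S′ ⊗ₛ T′) ST≋S′T′ ρ) (⟦⊗ₛ⟧-≐ S′ T′ ρ S′≐A′ T′≐B′))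

  symplectic-by-normalisation :
    ∀ {n} m (M : SMat n (m ℕ.+ m) (m ℕ.+ m)) (ν : Polynomial n) →
    True (Sympₛ m M ≋? (λ i j → ν :* Jₛ m i j)) → ∀ ρ → SympWith m (⟦ M ⟧ₘ ρ) (⟦ ν ⟧ ρ)
  symplectic-by-normalisation m M ν M-symp ρ i j = begin
    (transpose (⟦ M ⟧ₘ ρ) ⊗ (J m ⊗ ⟦ M ⟧ₘ ρ)) i j ≈⟨ ⟦Sympₛ⟧ ρ m M i j ⟨
    ⟦ Sympₛ m M i j ⟧ ρ                         ≈⟨ ≋-sound (Sympₛ m M) (λ i j → ν :* Jₛ m i j) M-symp ρ i j ⟩
    ⟦ ν ⟧ ρ * ⟦ Jₛ m i j ⟧ ρ                    ≈⟨ *-congˡ (⟦Jₛ⟧ ρ m i j) ⟩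
    ⟦ ν ⟧ ρ * J m i j                           ∎

  read-entry : ∀ {n a b} (S S′ : SMat n a b) ρ → ⟦ S ⟧ₘ ρ ≐ ⟦ S′ ⟧ₘ ρ →
               ∀ i j {L R} → T (equal? (S i j) L) → T (equal? (S′ i j) R) → ⟦ L ⟧ ρ ≈ ⟦ R ⟧ ρ
  read-entry S S′ ρ S≐S′ i j {L} {R} S≡L S′≡R =
    trans (sym (equal?-sound (S i j) L S≡L ρ)) (trans (S≐S′ i j) (equal?-sound (S′ i j) R S′≡R ρ))

  integralOver : ∀ {n} → (Fin n → Bool) → Polynomial n → Bool
  integralOver I (op _ p q) = integralOver I p ∧ integralOver I q
  integralOver I (con _)    = true
  integralOver I (var v)    = I v
  integralOver I (_ :^ _)   = false
  integralOver I (:- p)     = integralOver I p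

  ⟦+⟧ℤ-𝒪 : ∀ n → 𝒪 ⟦ + n ⟧ℤ
  ⟦+⟧ℤ-𝒪 zero          = 𝒪-0
  ⟦+⟧ℤ-𝒪 (suc zero)    = 𝒪-1
  ⟦+⟧ℤ-𝒪 (suc (suc n)) = 𝒪-+ (⟦+⟧ℤ-𝒪 (suc n)) 𝒪-1

  ⟦⟧ℤ-𝒪 : ∀ c → 𝒪 ⟦ c ⟧ℤ
  ⟦⟧ℤ-𝒪 (+ n)    = ⟦+⟧ℤ-𝒪 n
  ⟦⟧ℤ-𝒪 -[1+ n ] = 𝒪-neg (⟦+⟧ℤ-𝒪 (suc n))

  ⟦⟧-𝒪 : ∀ {n} (I : Fin n → Bool) ρ → (∀ v → T (I v) → 𝒪 (lookup ρ v)) →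
         ∀ p → T (integralOver I p) → 𝒪 (⟦ p ⟧ ρ)
  ⟦⟧-𝒪 I ρ vars-𝒪 (op o p q) p,q∈𝒪
    with Equivalence.to (T-∧ {integralOver I p} {integralOver I q}) p,q∈𝒪
  ⟦⟧-𝒪 I ρ vars-𝒪 (op [+] p q) _ | p∈𝒪 , q∈𝒪 = 𝒪-+ (⟦⟧-𝒪 I ρ vars-𝒪 p p∈𝒪) (⟦⟧-𝒪 I ρ vars-𝒪 q q∈𝒪)
  ⟦⟧-𝒪 I ρ vars-𝒪 (op [*] p q) _ | p∈𝒪 , q∈𝒪 = 𝒪-* (⟦⟧-𝒪 I ρ vars-𝒪 p p∈𝒪) (⟦⟧-𝒪 I ρ vars-𝒪 q q∈𝒪)
  ⟦⟧-𝒪 I ρ vars-𝒪 (con c) _   = ⟦⟧ℤ-𝒪 c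
  ⟦⟧-𝒪 I ρ vars-𝒪 (var v) v∈𝒪 = vars-𝒪 v v∈𝒪
  ⟦⟧-𝒪 I ρ vars-𝒪 (:- p)  p∈𝒪 = 𝒪-neg (⟦⟧-𝒪 I ρ vars-𝒪 p p∈𝒪)

  integral-by-syntax :
    ∀ {n a b} (I : Fin n → Bool) (M : SMat n a b) →
    True (Fin.all? λ i → Fin.all? λ j → T? (integralOver I (M i j))) →
    ∀ ρ → (∀ v → T (I v) → 𝒪 (lookup ρ v)) → Integral (⟦ M ⟧ₘ ρ)
  integral-by-syntax I M M-syntax ρ vars-𝒪 i j = ⟦⟧-𝒪 I ρ vars-𝒪 (M i j) (toWitness M-syntax i j)

  -- 𝒳_τ ⊆ H'_τᵢ

  module ȷ-Symbolic where
    aₛ bₛ cₛ dₛ pₛ sₛ tₛ : Polynomial 7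
    aₛ = var (# 0)
    bₛ = var (# 1)
    cₛ = var (# 2)
    dₛ = var (# 3)
    pₛ = var (# 4)
    sₛ = var (# 5)
    tₛ = var (# 6)

    integral : Fin 7 → Bool
    integral v = toℕ v ℕ.<ᵇ 5

    detₛ : Polynomial 7
    detₛ = aₛ :* dₛ :- bₛ :* cₛ

    Gₛ : SMat 7 2 2
    Gₛ = fromRows ((aₛ ∷ bₛ ∷ []) ∷ (cₛ ∷ dₛ ∷ []) ∷ [])

    ȷ₂ₛ : SMat 7 4 4
    ȷ₂ₛ = fromRows (Sᵣ.ȷ₂-rows aₛ bₛ cₛ dₛ)

    Hₛ Kₛ Tₛ T₀ₛ : SMat 7 6 6
    Hₛ  = embedₛ Gₛ ȷ₂ₛ
    Kₛ  = fromRows (Sᵣ.ȷ-conjugate-rows aₛ bₛ cₛ dₛ pₛ)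
    Tₛ  = fromRows (Sᵣ.τ-rows (tₛ :* pₛ) sₛ tₛ tₛ)
    T₀ₛ = fromRows (Sᵣ.τ-rows 1ₛ 1ₛ 1ₛ 0ₛ)

    module _ (g : Mat 2 2) (p s t : Carrier) where
      ρ₁ : Vec Carrier 7
      ρ₁ = g (# 0) (# 0) ∷ g (# 0) (# 1) ∷ g (# 1) (# 0) ∷ g (# 1) (# 1) ∷ p ∷ s ∷ t ∷ []

      ⟦ȷ₂ₛ⟧ : ⟦ ȷ₂ₛ ⟧ₘ ρ₁ ≐ ȷ₂ g
      ⟦ȷ₂ₛ⟧ = all₄ (all₄ refl refl refl refl) (all₄ refl refl refl refl)
                   (all₄ refl refl refl refl) (all₄ refl refl refl refl)

      ⟦Hₛ⟧ : ⟦ Hₛ ⟧ₘ ρ₁ ≐ embed g (ȷ₂ g)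
      ⟦Hₛ⟧ = ≐-trans (⟦embedₛ⟧ ρ₁ Gₛ ȷ₂ₛ) (embed-cong (all₂ (all₂ refl refl) (all₂ refl refl)) ⟦ȷ₂ₛ⟧)

      ⟦Kₛ⟧ : ⟦ Kₛ ⟧ₘ ρ₁ ≐ ȷ-conjugate g p
      ⟦Kₛ⟧ = ⟦fromRows⟧ ρ₁ (Sᵣ.ȷ-conjugate-rows aₛ bₛ cₛ dₛ pₛ)

      ⟦Tₛ⟧ : ⟦ Tₛ ⟧ₘ ρ₁ ≐ τ-matrix (t * p) s t t
      ⟦Tₛ⟧ = ⟦fromRows⟧ ρ₁ (Sᵣ.τ-rows (tₛ :* pₛ) sₛ tₛ tₛ)

      ⟦T₀ₛ⟧ : ⟦ T₀ₛ ⟧ₘ ρ₁ ≐ τ-matrix 1# 1# 1# 0#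
      ⟦T₀ₛ⟧ = ⟦fromRows⟧ ρ₁ (Sᵣ.τ-rows 1ₛ 1ₛ 1ₛ 0ₛ)

    variables-𝒪 : ∀ {g p s t} → Integral g → 𝒪 p → ∀ v → T (integral v) → 𝒪 (lookup (ρ₁ g p s t) v)
    variables-𝒪 g∈𝒪 p∈𝒪 zero                         _ = g∈𝒪 (# 0) (# 0)
    variables-𝒪 g∈𝒪 p∈𝒪 (suc zero)                   _ = g∈𝒪 (# 0) (# 1)
    variables-𝒪 g∈𝒪 p∈𝒪 (suc (suc zero))             _ = g∈𝒪 (# 1) (# 0)
    variables-𝒪 g∈𝒪 p∈𝒪 (suc (suc (suc zero)))       _ = g∈𝒪 (# 1) (# 1)
    variables-𝒪 g∈𝒪 p∈𝒪 (suc (suc (suc (suc zero)))) _ = p∈𝒪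

  module _ where
    open ȷ-Symbolic

    ȷ₂-symplectic : ∀ g → SympWith 2 (ȷ₂ g) (det2 g)
    ȷ₂-symplectic g = SympWith-resp {2} (⟦ȷ₂ₛ⟧ g 0# 0# 0#) refl
      (symplectic-by-normalisation 2 ȷ₂ₛ detₛ _ (ρ₁ g 0# 0# 0#))

    embed-ȷ-symplectic : ∀ g → SympWith 3 (embed g (ȷ₂ g)) (det2 g)
    embed-ȷ-symplectic g = SympWith-resp {3} (⟦Hₛ⟧ g 0# 0# 0#) refl
      (symplectic-by-normalisation 3 Hₛ detₛ _ (ρ₁ g 0# 0# 0#))

    ȷ-conjugate-symplectic : ∀ g p → SympWith 3 (ȷ-conjugate g p) (det2 g)
    ȷ-conjugate-symplectic g p = SympWith-resp {3} (⟦Kₛ⟧ g p 0# 0#) refl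
      (symplectic-by-normalisation 3 Kₛ detₛ _ (ρ₁ g p 0# 0#))

    embed-ȷ-integral : ∀ {g} → Integral g → Integral (embed g (ȷ₂ g))
    embed-ȷ-integral {g} g∈𝒪 = Integral-resp (⟦Hₛ⟧ g 0# 0# 0#)
      (integral-by-syntax integral Hₛ _ (ρ₁ g 0# 0# 0#) (variables-𝒪 g∈𝒪 𝒪-0))

    ȷ-conjugate-integral : ∀ {g p} → Integral g → 𝒪 p → Integral (ȷ-conjugate g p)
    ȷ-conjugate-integral {g} {p} g∈𝒪 p∈𝒪 = Integral-resp (⟦Kₛ⟧ g p 0# 0#)
      (integral-by-syntax integral Kₛ _ (ρ₁ g p 0# 0#) (variables-𝒪 g∈𝒪 p∈𝒪))

    embed-ȷ-commutes-with-τ₀ : ∀ g →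
      (embed g (ȷ₂ g) ⊗ τ-matrix 1# 1# 1# 0#) ≐ (τ-matrix 1# 1# 1# 0# ⊗ embed g (ȷ₂ g))
    embed-ȷ-commutes-with-τ₀ g = product-by-normalisation Hₛ T₀ₛ T₀ₛ Hₛ _ (ρ₁ g 0# 0# 0#)
      (⟦Hₛ⟧ g 0# 0# 0#) (⟦T₀ₛ⟧ g 0# 0# 0#) (⟦T₀ₛ⟧ g 0# 0# 0#) (⟦Hₛ⟧ g 0# 0# 0#)

    ȷ-conjugation : ∀ g {x s t} p → x ≈ t * p →
      (embed g (ȷ₂ g) ⊗ τ-matrix x s t t) ≐ (τ-matrix x s t t ⊗ ȷ-conjugate g p)
    ȷ-conjugation g {x} {s} {t} p x≈t*p =
      product-by-normalisation Hₛ Tₛ Tₛ Kₛ _ (ρ₁ g p s t) (⟦Hₛ⟧ g p s t) ⟦Tₛ⟧′ ⟦Tₛ⟧′ (⟦Kₛ⟧ g p s t)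
      where
      ⟦Tₛ⟧′ : ⟦ Tₛ ⟧ₘ (ρ₁ g p s t) ≐ τ-matrix x s t t
      ⟦Tₛ⟧′ = ≐-trans (⟦Tₛ⟧ g p s t) (τ-matrix-cong (sym x≈t*p) refl refl refl)

  conjugator : Fin 3 → Mat 2 2 → Mat 6 6
  conjugator zero             g = embed g (ȷ₂ g)
  conjugator (suc zero)       g = ȷ-conjugate g ϖ
  conjugator (suc (suc zero)) g = ȷ-conjugate g (ϖ * ϖ)

  conjugator-conjugates : ∀ i g → (embed g (ȷ₂ g) ⊗ τ i) ≐ (τ i ⊗ conjugator i g)
  conjugator-conjugates i g =
    conjugation-resp (embed g (ȷ₂ g)) (conjugator i g) (τ≐τᵢ-matrix i) (for-τᵢ-matrix i)
    where
    for-τᵢ-matrix : ∀ i → (embed g (ȷ₂ g) ⊗ τᵢ-matrix i) ≐ (τᵢ-matrix i ⊗ conjugator i g)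
    for-τᵢ-matrix zero             = embed-ȷ-commutes-with-τ₀ g
    for-τᵢ-matrix (suc zero)       = ȷ-conjugation g ϖ (sym (*-identityˡ ϖ))
    for-τᵢ-matrix (suc (suc zero)) = ȷ-conjugation g (ϖ * ϖ) ϖ≈ϖ⁻¹*[ϖ*ϖ]

  conjugator-integral : ∀ i {g} → Integral g → Integral (conjugator i g)
  conjugator-integral zero             g∈𝒪 = embed-ȷ-integral g∈𝒪
  conjugator-integral (suc zero)       g∈𝒪 = ȷ-conjugate-integral g∈𝒪 ϖ∈𝒪
  conjugator-integral (suc (suc zero)) g∈𝒪 = ȷ-conjugate-integral g∈𝒪 (𝒪-* ϖ∈𝒪 ϖ∈𝒪)

  conjugator-symplectic : ∀ i g → SympWith 3 (conjugator i g) (det2 g)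
  conjugator-symplectic zero             g = embed-ȷ-symplectic g
  conjugator-symplectic (suc zero)       g = ȷ-conjugate-symplectic g ϖ
  conjugator-symplectic (suc (suc zero)) g = ȷ-conjugate-symplectic g (ϖ * ϖ)

  ȷ-in-H'τ : ∀ i g → GL2𝒪 g → InH'τ i g (ȷ₂ g)
  ȷ-in-H'τ i g (g∈𝒪 , det-unit@(_ , _ , _ , det*y≈1)) =
      (invertible⇒nonzero det*y≈1 , ȷ₂-symplectic g)
    , conjugator i g
    , (conjugator-integral i g∈𝒪 , det2 g , det-unit , conjugator-symplectic i g)
    , conjugator-conjugates i g

  -- pr'₁(H'_τᵢ) ⊆ GL₂(𝒪_F)

  module Conjugation-Symbolic where
    aₛ bₛ cₛ dₛ xₛ sₛ tₛ uₛ : Polynomial 60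
    aₛ = var (# 0)
    bₛ = var (# 1)
    cₛ = var (# 2)
    dₛ = var (# 3)
    xₛ = var (# 4)
    sₛ = var (# 5)
    tₛ = var (# 6)
    uₛ = var (# 7)

    Aₛ : SMat 60 4 4
    Aₛ i j = var (8 ↑ʳ (combine i j ↑ˡ 36))

    κ Hₛ Tₛ : SMat 60 6 6
    κ i j = var (8 ↑ʳ (16 ↑ʳ combine i j))
    Hₛ = embedₛ (fromRows ((aₛ ∷ bₛ ∷ []) ∷ (cₛ ∷ dₛ ∷ []) ∷ [])) Aₛ
    Tₛ = fromRows (Sᵣ.τ-rows xₛ sₛ tₛ uₛ)

    module _ (g : Mat 2 2) (A : Mat 4 4) (k : Mat 6 6) (x s t u : Carrier) where
      ρ₂ : Vec Carrier 60
      ρ₂ = g (# 0) (# 0) ∷ g (# 0) (# 1) ∷ g (# 1) (# 0) ∷ g (# 1) (# 1) ∷ x ∷ s ∷ t ∷ u ∷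
           entries A ++ entries k

      ⟦Hₛ⟧ : ⟦ Hₛ ⟧ₘ ρ₂ ≐ embed g A
      ⟦Hₛ⟧ = ≐-trans (⟦embedₛ⟧ ρ₂ _ Aₛ) (embed-cong (all₂ (all₂ refl refl) (all₂ refl refl)) ⟦Aₛ⟧)
        where
        ⟦Aₛ⟧ : ⟦ Aₛ ⟧ₘ ρ₂ ≐ A
        ⟦Aₛ⟧ i j = reflexive
          (≡.trans (Vec.lookup-++ˡ (entries A) (entries k) (combine i j)) (lookup-entries A i j))

      ⟦κ⟧ : ⟦ κ ⟧ₘ ρ₂ ≐ k
      ⟦κ⟧ i j = reflexive
        (≡.trans (Vec.lookup-++ʳ (entries A) (entries k) (combine i j)) (lookup-entries k i j))

      ⟦Tₛ⟧ : ⟦ Tₛ ⟧ₘ ρ₂ ≐ τ-matrix x s t u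
      ⟦Tₛ⟧ = ⟦fromRows⟧ ρ₂ (Sᵣ.τ-rows xₛ sₛ tₛ uₛ)

  -- eᵢⱼ is entry (i, j) of embed g A ⊗ T = T ⊗ k, with both sides normalised.
  module Entries (g : Mat 2 2) (A : Mat 4 4) (k : Mat 6 6) (x s t u : Carrier)
                 (conj : (embed g A ⊗ τ-matrix x s t u) ≐ (τ-matrix x s t u ⊗ k)) where
    open Conjugation-Symbolic

    private
      ρ = ρ₂ g A k x s t u

      entry : ∀ i j {L R} → T (equal? ((Hₛ ⊗ₛ Tₛ) i j) L) → T (equal? ((Tₛ ⊗ₛ κ) i j) R) → ⟦ L ⟧ ρ ≈ ⟦ R ⟧ ρ
      entry = read-entry (Hₛ ⊗ₛ Tₛ) (Tₛ ⊗ₛ κ) ρ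
        (≐-trans (⟦⊗ₛ⟧-≐ Hₛ Tₛ ρ (⟦Hₛ⟧ g A k x s t u) (⟦Tₛ⟧ g A k x s t u))
          (≐-trans conj (≐-sym (⟦⊗ₛ⟧-≐ Tₛ κ ρ (⟦Tₛ⟧ g A k x s t u) (⟦κ⟧ g A k x s t u)))))

    e₀₀ : x * g (# 0) (# 0) ≈ x * k (# 0) (# 0) + u * k (# 4) (# 0)
    e₀₀ = entry (# 0) (# 0) {xₛ :* aₛ} {xₛ :* κ (# 0) (# 0) :+ uₛ :* κ (# 4) (# 0)} _ _

    e₁₀ : 0# ≈ x * k (# 1) (# 0) + u * k (# 3) (# 0)
    e₁₀ = entry (# 1) (# 0) {0ₛ} {xₛ :* κ (# 1) (# 0) :+ uₛ :* κ (# 3) (# 0)} _ _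

    e₂₀ : 0# ≈ s * k (# 2) (# 0)
    e₂₀ = entry (# 2) (# 0) {0ₛ} {sₛ :* κ (# 2) (# 0)} _ _

    e₃₀ : x * g (# 1) (# 0) ≈ t * k (# 3) (# 0)
    e₃₀ = entry (# 3) (# 0) {xₛ :* cₛ} {tₛ :* κ (# 3) (# 0)} _ _

    e₄₀ : 0# ≈ t * k (# 4) (# 0)
    e₄₀ = entry (# 4) (# 0) {0ₛ} {tₛ :* κ (# 4) (# 0)} _ _

    e₅₀ : 0# ≈ k (# 5) (# 0)
    e₅₀ = entry (# 5) (# 0) {0ₛ} {κ (# 5) (# 0)} _ _

    e₀₃ : t * g (# 0) (# 1) ≈ x * k (# 0) (# 3) + u * k (# 4) (# 3)
    e₀₃ = entry (# 0) (# 3) {tₛ :* bₛ} {xₛ :* κ (# 0) (# 3) :+ uₛ :* κ (# 4) (# 3)} _ _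

    e₃₃ : t * g (# 1) (# 1) ≈ t * k (# 3) (# 3)
    e₃₃ = entry (# 3) (# 3) {tₛ :* dₛ} {tₛ :* κ (# 3) (# 3)} _ _

    e₃₄ : u * g (# 1) (# 0) ≈ t * k (# 3) (# 4)
    e₃₄ = entry (# 3) (# 4) {uₛ :* cₛ} {tₛ :* κ (# 3) (# 4)} _ _

    symplectic-entry : ∀ {ν} → SympWith 3 k ν → pairing (λ r → k r (# 0)) (λ r → k r (# 3)) ≈ ν * 1#
    symplectic-entry {ν} k-symp = begin
      ⟦ ω₀₃ ⟧ ρ                                             ≈⟨ equal?-sound (Sympₛ 3 κ (# 0) (# 3)) ω₀₃ _ ρ ⟨
      ⟦ Sympₛ 3 κ (# 0) (# 3) ⟧ ρ                           ≈⟨ ⟦Sympₛ⟧ ρ 3 κ (# 0) (# 3) ⟩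
      (transpose (⟦ κ ⟧ₘ ρ) ⊗ (J 3 ⊗ ⟦ κ ⟧ₘ ρ)) (# 0) (# 3) ≈⟨ ⊗-cong ⟦κ⟧ᵀ (⊗-cong (≐-refl {A = J 3}) ⟦κ⟧′) _ _ ⟩
      (transpose k ⊗ (J 3 ⊗ k)) (# 0) (# 3)                 ≈⟨ k-symp (# 0) (# 3) ⟩
      ν * 1#                                                ∎
      where
      ω₀₃ = Sᵣ.pairing (λ r → κ r (# 0)) (λ r → κ r (# 3))
      ⟦κ⟧′ = ⟦κ⟧ g A k x s t u
      ⟦κ⟧ᵀ : transpose (⟦ κ ⟧ₘ ρ) ≐ transpose k
      ⟦κ⟧ᵀ i j = ⟦κ⟧′ j i

  pairing-congˡ : ∀ {v v′} w → (∀ r → v r ≈ v′ r) → pairing v w ≈ pairing v′ w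
  pairing-congˡ w v≈v′ =
    +-cong (+-cong (+-cong (*-congʳ (v≈v′ (# 0))) (-‿cong (*-congʳ (v≈v′ (# 3)))))
                   (+-cong (*-congʳ (v≈v′ (# 1))) (-‿cong (*-congʳ (v≈v′ (# 4))))))
           (+-cong (*-congʳ (v≈v′ (# 2))) (-‿cong (*-congʳ (v≈v′ (# 5)))))

  pairing-column : ∀ a c p q (w : Fin 6 → Carrier) →
    pairing (lookup (a ∷ - (q * c) ∷ 0# ∷ p * c ∷ 0# ∷ 0# ∷ [])) w
      ≈ a * w (# 3) - c * (p * w (# 0) + q * w (# 4))
  pairing-column a c p q w = solve 10
    (λ a c p q w₀ w₁ w₂ w₃ w₄ w₅ →
        (a :* w₃ :+ :- (p :* c :* w₀)) :+ (:- (q :* c) :* w₄ :+ :- (0ₛ :* w₁)) :+ (0ₛ :* w₅ :+ :- (0ₛ :* w₂))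
      , a :* w₃ :- c :* (p :* w₀ :+ q :* w₄))
    refl a c p q (w (# 0)) (w (# 1)) (w (# 2)) (w (# 3)) (w (# 4)) (w (# 5))

  record IntegralRatios (x s t u : Carrier) : Set where
    field
      p q α β   : Carrier
      x≈t*p     : x ≈ t * p
      u≈t*q     : u ≈ t * q
      α*p+β*q≈1 : α * p + β * q ≈ 1#
      p∈𝒪       : 𝒪 p
      q∈𝒪       : 𝒪 q
      α∈𝒪       : 𝒪 α
      β∈𝒪       : 𝒪 β
      x≉0       : ¬ x ≈ 0#
      s≉0       : ¬ s ≈ 0#
      t≉0       : ¬ t ≈ 0#

  module Analysis (g : Mat 2 2) (A : Mat 4 4) (k : Mat 6 6) {x s t u : Carrier}
                  (conj : (embed g A ⊗ τ-matrix x s t u) ≐ (τ-matrix x s t u ⊗ k))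
                  (ratios : IntegralRatios x s t u) where
    open Entries g A k x s t u conj
    open IntegralRatios ratios

    a b c d : Carrier
    a = g (# 0) (# 0)
    b = g (# 0) (# 1)
    c = g (# 1) (# 0)
    d = g (# 1) (# 1)

    k₄₀≈0 : k (# 4) (# 0) ≈ 0#
    k₄₀≈0 = nonzero-*-zero t≉0 e₄₀

    k₂₀≈0 : k (# 2) (# 0) ≈ 0#
    k₂₀≈0 = nonzero-*-zero s≉0 e₂₀

    k₀₀≈a : k (# 0) (# 0) ≈ a
    k₀₀≈a = nonzero-cancelˡ x≉0 (begin
      x * k (# 0) (# 0)                      ≈⟨ +-identityʳ _ ⟨
      x * k (# 0) (# 0) + 0#                 ≈⟨ +-congˡ (trans (sym (zeroʳ u)) (*-congˡ (sym k₄₀≈0))) ⟩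
      x * k (# 0) (# 0) + u * k (# 4) (# 0)  ≈⟨ e₀₀ ⟨
      x * a                                  ∎)

    k₃₀≈p*c : k (# 3) (# 0) ≈ p * c
    k₃₀≈p*c = nonzero-cancelˡ t≉0 (begin
      t * k (# 3) (# 0)  ≈⟨ e₃₀ ⟨
      x * c              ≈⟨ *-congʳ x≈t*p ⟩
      t * p * c          ≈⟨ *-assoc t p c ⟩
      t * (p * c)        ∎)

    k₁₀≈-q*c : k (# 1) (# 0) ≈ - (q * c)
    k₁₀≈-q*c = nonzero-cancelˡ x≉0 (begin
      x * k (# 1) (# 0)      ≈⟨ inverseˡ-unique _ _ (sym e₁₀) ⟩
      - (u * k (# 3) (# 0))  ≈⟨ -‿cong (*-cong u≈t*q k₃₀≈p*c) ⟩
      - (t * q * (p * c))    ≈⟨ solve 4 (λ t q p c → :- (t :* q :* (p :* c)) , t :* p :* :- (q :* c))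
                                        refl t q p c ⟩
      t * p * - (q * c)      ≈⟨ *-congʳ x≈t*p ⟨
      x * - (q * c)          ∎)

    column₀-value : Vec Carrier 6
    column₀-value = a ∷ - (q * c) ∷ 0# ∷ p * c ∷ 0# ∷ 0# ∷ []

    column₀ : ∀ r → k r (# 0) ≈ lookup column₀-value r
    column₀ = all₆ k₀₀≈a k₁₀≈-q*c k₂₀≈0 k₃₀≈p*c k₄₀≈0 (sym e₅₀)

    k₃₃≈d : k (# 3) (# 3) ≈ d
    k₃₃≈d = nonzero-cancelˡ t≉0 (sym e₃₃)

    b≈p*k₀₃+q*k₄₃ : b ≈ p * k (# 0) (# 3) + q * k (# 4) (# 3)
    b≈p*k₀₃+q*k₄₃ = nonzero-cancelˡ t≉0 (begin
      t * b                                          ≈⟨ e₀₃ ⟩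
      x * k (# 0) (# 3) + u * k (# 4) (# 3)          ≈⟨ +-cong (*-congʳ x≈t*p) (*-congʳ u≈t*q) ⟩
      t * p * k (# 0) (# 3) + t * q * k (# 4) (# 3)  ≈⟨ solve 5 (λ t p q y z → t :* p :* y :+ t :* q :* z
                                                                             , t :* (p :* y :+ q :* z))
                                                              refl t p q _ _ ⟩
      t * (p * k (# 0) (# 3) + q * k (# 4) (# 3))    ∎)

    q*c≈k₃₄ : q * c ≈ k (# 3) (# 4)
    q*c≈k₃₄ = nonzero-cancelˡ t≉0 (begin
      t * (q * c)        ≈⟨ *-assoc t q c ⟨
      t * q * c          ≈⟨ *-congʳ u≈t*q ⟨
      u * c              ≈⟨ e₃₄ ⟩
      t * k (# 3) (# 4)  ∎)

    c≈α*k₃₀+β*k₃₄ : c ≈ α * k (# 3) (# 0) + β * k (# 3) (# 4)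
    c≈α*k₃₀+β*k₃₄ = begin
      c                                      ≈⟨ *-identityˡ c ⟨
      1# * c                                 ≈⟨ *-congʳ α*p+β*q≈1 ⟨
      (α * p + β * q) * c                    ≈⟨ solve 5 (λ α p β q c → (α :* p :+ β :* q) :* c
                                                                     , α :* (p :* c) :+ β :* (q :* c))
                                                      refl α p β q c ⟩
      α * (p * c) + β * (q * c)              ≈⟨ +-cong (*-congˡ (sym k₃₀≈p*c)) (*-congˡ q*c≈k₃₄) ⟩
      α * k (# 3) (# 0) + β * k (# 3) (# 4)  ∎

    g-integral : Integral k → Integral g
    g-integral k∈𝒪 = all₂
      (all₂ (𝒪-resp k₀₀≈a (k∈𝒪 (# 0) (# 0)))
            (𝒪-resp (sym b≈p*k₀₃+q*k₄₃) (𝒪-+ (𝒪-* p∈𝒪 (k∈𝒪 (# 0) (# 3))) (𝒪-* q∈𝒪 (k∈𝒪 (# 4) (# 3))))))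
      (all₂ (𝒪-resp (sym c≈α*k₃₀+β*k₃₄) (𝒪-+ (𝒪-* α∈𝒪 (k∈𝒪 (# 3) (# 0))) (𝒪-* β∈𝒪 (k∈𝒪 (# 3) (# 4)))))
            (𝒪-resp k₃₃≈d (k∈𝒪 (# 3) (# 3))))

    similitude≈det : ∀ {ν} → SympWith 3 k ν → ν ≈ det2 g
    similitude≈det {ν} k-symp = begin
      ν                                     ≈⟨ *-identityʳ ν ⟨
      ν * 1#                                ≈⟨ symplectic-entry k-symp ⟨
      pairing k₀ k₃                         ≈⟨ pairing-congˡ k₃ column₀ ⟩
      pairing (lookup column₀-value) k₃     ≈⟨ pairing-column a c p q k₃ ⟩
      a * k₃ (# 3) - c * (p * k₃ (# 0) + q * k₃ (# 4))
                                            ≈⟨ +-cong (*-congˡ k₃₃≈d) (-‿cong (*-congˡ (sym b≈p*k₀₃+q*k₄₃))) ⟩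
      a * d - c * b                         ≈⟨ +-congˡ (-‿cong (*-comm c b)) ⟩
      det2 g                                ∎
      where
      k₀ k₃ : Fin 6 → Carrier
      k₀ r = k r (# 0)
      k₃ r = k r (# 3)

  record StandardForm (T : Mat 6 6) : Set where
    field
      x s t u : Carrier
      shape   : T ≐ τ-matrix x s t u
      ratios  : IntegralRatios x s t u

  pr₁-in-GL₂𝒪 : ∀ {T} → StandardForm T → ∀ g A k → InK k → (embed g A ⊗ T) ≐ (T ⊗ k) → GL2𝒪 g
  pr₁-in-GL₂𝒪 std g A k (k∈𝒪 , ν , ν-unit , k-symp) conj =
    g-integral k∈𝒪 , Unit𝒪-resp (similitude≈det k-symp) ν-unit
    where
    open StandardForm std
    open Analysis g A k (conjugation-resp (embed g A) k (≐-sym shape) conj) ratios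

  τ₀-ratios : IntegralRatios 1# 1# 1# 0#
  τ₀-ratios = record
    { p = 1# ; q = 0# ; α = 1# ; β = 0#
    ; x≈t*p = sym (*-identityˡ 1#) ; u≈t*q = sym (zeroʳ 1#)
    ; α*p+β*q≈1 = trans (+-congˡ (zeroˡ 0#)) (trans (+-identityʳ _) (*-identityˡ 1#))
    ; p∈𝒪 = 𝒪-1 ; q∈𝒪 = 𝒪-0 ; α∈𝒪 = 𝒪-1 ; β∈𝒪 = 𝒪-0
    ; x≉0 = 1≉0 ; s≉0 = 1≉0 ; t≉0 = 1≉0
    }

  τ₁-ratios : IntegralRatios ϖ ϖ 1# 1#
  τ₁-ratios = record
    { p = ϖ ; q = 1# ; α = 0# ; β = 1#
    ; x≈t*p = sym (*-identityˡ ϖ) ; u≈t*q = sym (*-identityˡ 1#)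
    ; α*p+β*q≈1 = trans (+-congʳ (zeroˡ ϖ)) (trans (+-identityˡ _) (*-identityˡ 1#))
    ; p∈𝒪 = ϖ∈𝒪 ; q∈𝒪 = 𝒪-1 ; α∈𝒪 = 𝒪-0 ; β∈𝒪 = 𝒪-1
    ; x≉0 = ϖ≉0 ; s≉0 = ϖ≉0 ; t≉0 = 1≉0
    }

  τ₂-ratios : IntegralRatios ϖ 1# ϖ⁻¹ ϖ⁻¹
  τ₂-ratios = record
    { p = ϖ * ϖ ; q = 1# ; α = 0# ; β = 1#
    ; x≈t*p = ϖ≈ϖ⁻¹*[ϖ*ϖ] ; u≈t*q = sym (*-identityʳ ϖ⁻¹)
    ; α*p+β*q≈1 = trans (+-congʳ (zeroˡ (ϖ * ϖ))) (trans (+-identityˡ _) (*-identityˡ 1#))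
    ; p∈𝒪 = 𝒪-* ϖ∈𝒪 ϖ∈𝒪 ; q∈𝒪 = 𝒪-1 ; α∈𝒪 = 𝒪-0 ; β∈𝒪 = 𝒪-1
    ; x≉0 = ϖ≉0 ; s≉0 = 1≉0 ; t≉0 = ϖ⁻¹≉0
    }

  τ-standard : ∀ i → StandardForm (τ i)
  τ-standard zero             = record { shape = τ≐τᵢ-matrix (# 0) ; ratios = τ₀-ratios }
  τ-standard (suc zero)       = record { shape = τ≐τᵢ-matrix (# 1) ; ratios = τ₁-ratios }
  τ-standard (suc (suc zero)) = record { shape = τ≐τᵢ-matrix (# 2) ; ratios = τ₂-ratios }

  pr₁-of-H'τ : ∀ i {g A} → InH'τ i g A → GL2𝒪 g
  pr₁-of-H'τ i {g} {A} (_ , k , k∈K , conj) = pr₁-in-GL₂𝒪 (τ-standard i) g A k k∈K conj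

lemma7p2p9 : (F : LocalField) → let open WithF F in
    ((i : Fin 3) → (g : Mat 2 2) → GL2𝒪 g → InH'τ i g (ȷ₂ g))
    ×
    ((i : Fin 3) → (g : Mat 2 2) →
       (Σ (Mat 4 4) (λ A → InH'τ i g A)) ⇔ GL2𝒪 g)
lemma7p2p9 F =
    ȷ-in-H'τ F
  , λ i g → mk⇔ (λ (_ , A∈H'τ) → pr₁-of-H'τ F i A∈H'τ)
                (λ g∈GL₂𝒪 → WithF.ȷ₂ F g , ȷ-in-H'τ F i g g∈GL₂𝒪)
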